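{- Let $r\ge 2$ and let $H$ be an intersecting $r$-partite hypergraph in which every vertex has positive degree, and suppose $\tau(H)=r$. Then: (i) each side of $H$ has size at least $r$; (ii) each vertex of $H$ has degree at least $2$; (iii) each line of $H$ contains at most one vertex of degree $2$.
   Context: A hypergraph $H$ is a set of non-empty subsets (lines) of a finite vertex set $V(H)$. The degree of a vertex is the number of lines containing it. $H$ is $r$-partite if $V(H)$ is partitioned into $r$ sets $V_0,\dots,V_{r-1}$ (sides) such that every line contains exactly one vertex from each side. A cover is a set of vertices meeting every line; $\tau(H)$ is the minimum size of a cover. $H$ is intersecting if every two lines share at least one vertex. -}

module Defs where

open import Data.Nat using (ℕ; _≤_)
open import Data.Fin using (Fin; _≟_)
open import Data.Fin.Subset using (Subset; _∈_; _∉_; Nonempty; ∣_∣)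
open import Data.Fin.Subset.Properties using (_∈?_)
open import Data.List using (List; filter; length)
open import Data.List.Membership.Propositional renaming (_∈_ to _∈ₗ_)
open import Data.List.Relation.Unary.All using (All)
open import Data.List.Relation.Unary.Unique.Propositional using (Unique)
open import Data.Vec using (tabulate)
open import Data.Product using (Σ; ∃; _×_)
open import Relation.Binary.PropositionalEquality using (_≡_)
open import Relation.Nullary using (does)

record Hypergraph (n : ℕ) : Set where
  field
    lines    : List (Subset n)
    distinct : Unique lines
    nonempty : All Nonempty lines
open Hypergraph public

degree : ∀ {n} → Hypergraph n → Fin n → ℕ
degree H v = length (filter (v ∈?_) (lines H))

_∈H_ : ∀ {n} → Subset n → Hypergraph n → Set
L ∈H H = L ∈ₗ lines H

-- H is r-partite w.r.t. the side assignment  side : Fin n → Fin r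
-- (vertex v lies in side V_(side v)): every line contains exactly one
-- vertex of each side.
IsPartition : ∀ {n} (r : ℕ) → Hypergraph n → (Fin n → Fin r) → Set
IsPartition {n} r H side =
  ∀ L → L ∈H H → ∀ (i : Fin r) →
    ∃ λ (v : Fin n) → v ∈ L × side v ≡ i ×
      (∀ w → w ∈ L → side w ≡ i → w ≡ v)

sideSet : ∀ {n r} → (Fin n → Fin r) → Fin r → Subset n
sideSet side i = tabulate (λ v → does (side v ≟ i))

IsIntersecting : ∀ {n} → Hypergraph n → Set
IsIntersecting H = ∀ L M → L ∈H H → M ∈H H → ∃ λ v → v ∈ L × v ∈ M

IsCover : ∀ {n} → Hypergraph n → Subset n → Set
IsCover H C = ∀ L → L ∈H H → ∃ λ v → v ∈ C × v ∈ L

CoverNumber≡ : ∀ {n} → Hypergraph n → ℕ → Set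
CoverNumber≡ {n} H k =
  (∃ λ (C : Subset n) → IsCover H C × ∣ C ∣ ≡ k) ×
  (∀ (C : Subset n) → IsCover H C → k ≤ ∣ C ∣)

module Submission where

-- Each part of the theorem is proved by exhibiting a
-- cover and comparing its size with τ(H) ≥ r.
--   (i)   Every side V_i meets every line, so V_i is a cover and |V_i| ≥ r.
--   (ii)  If v has degree 1 and L is its unique line, then L ∖ {v} is a cover
--         with fewer than |L| ≤ r vertices: a line through a vertex z ≠ v of
--         L is met in z, and the only line through v is L, which contains a
--         vertex on a side other than that of v.
--   (iii) If v ≠ w in L both have degree 2, let L_v, L_w be their second
--         lines and u ∈ L_v ∩ L_w.  Then (L ∖ {v, w}) ∪ {u} is a cover with
--         at most |L| − 1 < r vertices.
-- Both covers are certified by one principle: in an intersecting hypergraph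
-- every line meets a fixed line L, so a set meeting every line through
-- every vertex of L is a cover.

open import Defs
open import Data.Nat using (ℕ; zero; suc; _+_; _≤_; _<_; z≤n; s≤s)
open import Data.Nat.Properties using (+-comm; +-suc; ≤-trans; m≤n⇒m≤1+n; ≤⇒≯; module ≤-Reasoning)
open import Data.Fin using (Fin; punchIn; punchOut) renaming (zero to fzero; suc to fsuc; _≟_ to _≟ᶠ_)
open import Data.Fin.Properties using (punchInᵢ≢i; punchOut-injective; suc-injective)
open import Data.Fin.Subset using (Subset; _∈_; ∣_∣; _∪_; _-_; ⁅_⁆; inside; outside)
open import Data.Fin.Subset.Properties using (_∈?_; x∈p∪q⁺; x∈⁅x⁆; ∣⁅x⁆∣≡1; x∈p∧x≢y⇒x∈p-y; x∈p⇒∣p-x∣<∣p∣)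
open import Data.Vec using ([]; _∷_; here; there)
open import Data.Vec.Properties using (lookup∘tabulate; lookup⇒[]=)
open import Data.List using (List; length; filter) renaming ([] to []ₗ; _∷_ to _∷ₗ_)
open import Data.List.Membership.Propositional using () renaming (_∈_ to _∈ₗ_)
open import Data.List.Membership.Propositional.Properties using (∈-filter⁺; ∈-filter⁻)
open import Data.List.Relation.Unary.Any using () renaming (here to hereₗ; there to thereₗ)
open import Data.Product using (_×_; _,_; ∃)
open import Data.Sum using (_⊎_; inj₁; inj₂)
open import Data.Empty using (⊥-elim)
open import Relation.Nullary using (¬_; yes; no)
open import Relation.Nullary.Decidable using (dec-true)
open import Relation.Binary.PropositionalEquality using (_≡_; _≢_; refl; sym; trans; cong; subst)

∣p∪q∣≤∣p∣+∣q∣ : ∀ {n} (p q : Subset n) → ∣ p ∪ q ∣ ≤ ∣ p ∣ + ∣ q ∣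
∣p∪q∣≤∣p∣+∣q∣ []            []            = z≤n
∣p∪q∣≤∣p∣+∣q∣ (outside ∷ p) (outside ∷ q) = ∣p∪q∣≤∣p∣+∣q∣ p q
∣p∪q∣≤∣p∣+∣q∣ (outside ∷ p) (inside ∷ q)  =
  subst (suc ∣ p ∪ q ∣ ≤_) (sym (+-suc ∣ p ∣ ∣ q ∣)) (s≤s (∣p∪q∣≤∣p∣+∣q∣ p q))
∣p∪q∣≤∣p∣+∣q∣ (inside ∷ p)  (outside ∷ q) = s≤s (∣p∪q∣≤∣p∣+∣q∣ p q)
∣p∪q∣≤∣p∣+∣q∣ (inside ∷ p)  (inside ∷ q)  =
  s≤s (subst (∣ p ∪ q ∣ ≤_) (sym (+-suc ∣ p ∣ ∣ q ∣)) (m≤n⇒m≤1+n (∣p∪q∣≤∣p∣+∣q∣ p q)))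

injection⇒∣p∣≤ : ∀ {n m} (p : Subset n) (g : ∀ x → x ∈ p → Fin m) →
  (∀ {x y} (x∈p : x ∈ p) (y∈p : y ∈ p) → g x x∈p ≡ g y y∈p → x ≡ y) →
  ∣ p ∣ ≤ m
injection⇒∣p∣≤ []            g g-inj = z≤n
injection⇒∣p∣≤ (outside ∷ p) g g-inj =
  injection⇒∣p∣≤ p (λ x x∈p → g (fsuc x) (there x∈p))
    (λ x∈p y∈p eq → suc-injective (g-inj (there x∈p) (there y∈p) eq))
injection⇒∣p∣≤ {m = zero}  (inside ∷ p) g g-inj with g fzero here
... | ()
injection⇒∣p∣≤ {m = suc m} (inside ∷ p) g g-inj =
  s≤s (injection⇒∣p∣≤ p g′ g′-inj)
  where
  -- the value of 0 is never taken again, so it can be removed from the codomain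
  g0≢g : ∀ {x} (x∈p : x ∈ p) → g fzero here ≢ g (fsuc x) (there x∈p)
  g0≢g x∈p eq with g-inj here (there x∈p) eq
  ... | ()
  g′ : ∀ x → x ∈ p → Fin m
  g′ x x∈p = punchOut (g0≢g x∈p)
  g′-inj : ∀ {x y} (x∈p : x ∈ p) (y∈p : y ∈ p) → g′ x x∈p ≡ g′ y y∈p → x ≡ y
  g′-inj x∈p y∈p eq =
    suc-injective (g-inj (there x∈p) (there y∈p) (punchOut-injective (g0≢g x∈p) (g0≢g y∈p) eq))

length≡1⇒single : ∀ {A : Set} (xs : List A) → length xs ≡ 1 →
  ∃ λ a → a ∈ₗ xs × (∀ {b} → b ∈ₗ xs → b ≡ a)
length≡1⇒single (a ∷ₗ []ₗ) refl = a , hereₗ refl , λ { (hereₗ b≡a) → b≡a }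

length≡2⇒pair : ∀ {A : Set} (xs : List A) {a : A} → length xs ≡ 2 → a ∈ₗ xs →
  ∃ λ b → b ∈ₗ xs × (∀ {c} → c ∈ₗ xs → c ≡ a ⊎ c ≡ b)
length≡2⇒pair (x ∷ₗ y ∷ₗ []ₗ) refl (hereₗ refl) =
  y , thereₗ (hereₗ refl) , λ { (hereₗ c≡x) → inj₁ c≡x ; (thereₗ (hereₗ c≡y)) → inj₂ c≡y }
length≡2⇒pair (x ∷ₗ y ∷ₗ []ₗ) refl (thereₗ (hereₗ refl)) =
  x , hereₗ refl , λ { (hereₗ c≡x) → inj₂ c≡x ; (thereₗ (hereₗ c≡y)) → inj₁ c≡y }

anotherSide : ∀ {r} → 2 ≤ r → (i : Fin r) → ∃ λ j → j ≢ i
anotherSide (s≤s (s≤s _)) i = punchIn i fzero , punchInᵢ≢i i fzero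

module _ {n : ℕ} (H : Hypergraph n) where

  linesThrough : Fin n → List (Subset n)
  linesThrough v = filter (v ∈?_) (lines H)

  degree≡1⇒uniqueLine : ∀ {v} → degree H v ≡ 1 →
    ∃ λ L → L ∈H H × v ∈ L × (∀ M → M ∈H H → v ∈ M → M ≡ L)
  degree≡1⇒uniqueLine {v} d≡1 with length≡1⇒single (linesThrough v) d≡1
  ... | L , L∈ , unique with ∈-filter⁻ (v ∈?_) L∈
  ...   | L∈H , v∈L = L , L∈H , v∈L , λ M M∈H v∈M → unique (∈-filter⁺ (v ∈?_) M∈H v∈M)

  degree≡2⇒secondLine : ∀ {v L} → degree H v ≡ 2 → L ∈H H → v ∈ L →
    ∃ λ L′ → L′ ∈H H × v ∈ L′ × (∀ M → M ∈H H → v ∈ M → M ≡ L ⊎ M ≡ L′)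
  degree≡2⇒secondLine {v} d≡2 L∈H v∈L
    with length≡2⇒pair (linesThrough v) d≡2 (∈-filter⁺ (v ∈?_) L∈H v∈L)
  ... | L′ , L′∈ , onlyTwo with ∈-filter⁻ (v ∈?_) L′∈
  ...   | L′∈H , v∈L′ = L′ , L′∈H , v∈L′ , λ M M∈H v∈M → onlyTwo (∈-filter⁺ (v ∈?_) M∈H v∈M)

  coverThroughLine : IsIntersecting H → ∀ {L} → L ∈H H → (C : Subset n) →
    (∀ {z M} → z ∈ L → M ∈H H → z ∈ M → ∃ λ x → x ∈ C × x ∈ M) →
    IsCover H C
  coverThroughLine intersecting L∈H C meetsLinesThrough M M∈H
    with intersecting _ M L∈H M∈H
  ... | z , z∈L , z∈M = meetsLinesThrough z∈L M∈H z∈M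

module Partite {n r : ℕ} (H : Hypergraph n) (side : Fin n → Fin r)
               (partite : IsPartition r H side) where

  sameSide⇒≡ : ∀ {L x y} → L ∈H H → x ∈ L → y ∈ L → side x ≡ side y → x ≡ y
  sameSide⇒≡ L∈H x∈L y∈L eq with partite _ L∈H _
  ... | _ , _ , _ , unique = trans (unique _ x∈L eq) (sym (unique _ y∈L refl))

  -- A line has at most r vertices, since side is injective on it.
  lineSize≤ : ∀ {L} → L ∈H H → ∣ L ∣ ≤ r
  lineSize≤ L∈H = injection⇒∣p∣≤ _ (λ x _ → side x) (sameSide⇒≡ L∈H)

  sideCovers : ∀ i → IsCover H (sideSet side i)
  sideCovers i M M∈H with partite M M∈H i
  ... | x , x∈M , sx≡i , _ = x , x∈side , x∈M
    where
    x∈side : x ∈ sideSet side i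
    x∈side = lookup⇒[]= x _ (trans (lookup∘tabulate _ x) (dec-true (side x ≟ᶠ i) sx≡i))

  anotherVertex : 2 ≤ r → ∀ {L v} → L ∈H H → v ∈ L → ∃ λ x → x ∈ L × x ≢ v
  anotherVertex r≥2 {v = v} L∈H v∈L with anotherSide r≥2 (side v)
  ... | j , j≢sv with partite _ L∈H j
  ...   | x , x∈L , sx≡j , _ = x , x∈L , λ { refl → j≢sv (sym sx≡j) }

-- Parts (i)-(iii), assuming r-partiteness and only the lower bound τ(H) ≥ r.
module AtLeastRCover {n r : ℕ} (H : Hypergraph n) (side : Fin n → Fin r)
                     (partite : IsPartition r H side)
                     (τ≥r : ∀ C → IsCover H C → r ≤ ∣ C ∣) where
  open Partite H side partite

  noSmallCover : ∀ C → IsCover H C → ¬ (∣ C ∣ < r)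
  noSmallCover C cover = ≤⇒≯ (τ≥r C cover)

  sideSize≥r : ∀ i → r ≤ ∣ sideSet side i ∣
  sideSize≥r i = τ≥r _ (sideCovers i)

  -- (ii) no vertex of an intersecting H has degree 1: L ∖ {v} would be a small cover
  degree≢1 : 2 ≤ r → IsIntersecting H → ∀ v → degree H v ≢ 1
  degree≢1 r≥2 intersecting v d≡1 with degree≡1⇒uniqueLine H d≡1
  ... | L , L∈H , v∈L , onlyL = noSmallCover (L - v) cover small
    where
    small : ∣ L - v ∣ < r
    small = ≤-trans (x∈p⇒∣p-x∣<∣p∣ v∈L) (lineSize≤ L∈H)
    cover : IsCover H (L - v)
    cover = coverThroughLine H intersecting L∈H (L - v) meets
      where
      meets : ∀ {z M} → z ∈ L → M ∈H H → z ∈ M → ∃ λ x → x ∈ L - v × x ∈ M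
      meets {z} z∈L M∈H z∈M with z ≟ᶠ v
      ... | no z≢v = z , x∈p∧x≢y⇒x∈p-y z∈L z≢v , z∈M
      ... | yes refl with onlyL _ M∈H z∈M | anotherVertex r≥2 L∈H v∈L
      ...   | refl | x , x∈L , x≢v = x , x∈p∧x≢y⇒x∈p-y x∈L x≢v , x∈L

  degree2Unique : IsIntersecting H → ∀ {L v w} → L ∈H H → v ∈ L → w ∈ L →
    degree H v ≡ 2 → degree H w ≡ 2 → v ≡ w
  degree2Unique intersecting {L} {v} {w} L∈H v∈L w∈L dv≡2 dw≡2 with v ≟ᶠ w
  ... | yes v≡w = v≡w
  ... | no v≢w
    with degree≡2⇒secondLine H dv≡2 L∈H v∈L | degree≡2⇒secondLine H dw≡2 L∈H w∈L
  ...   | Lv , Lv∈H , v∈Lv , linesThroughV | Lw , Lw∈H , w∈Lw , linesThroughW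
    with intersecting Lv Lw Lv∈H Lw∈H
  ...     | u , u∈Lv , u∈Lw = ⊥-elim (noSmallCover C cover small)
    where
    C : Subset n
    C = (L - v - w) ∪ ⁅ u ⁆

    rest⊆C : ∀ {x} → x ∈ L → x ≢ v → x ≢ w → x ∈ C
    rest⊆C x∈L x≢v x≢w = x∈p∪q⁺ (inj₁ (x∈p∧x≢y⇒x∈p-y (x∈p∧x≢y⇒x∈p-y x∈L x≢v) x≢w))

    u∈C : u ∈ C
    u∈C = x∈p∪q⁺ (inj₂ (x∈⁅x⁆ u))

    small : ∣ C ∣ < r
    small = begin-strict
      ∣ C ∣                       ≤⟨ ∣p∪q∣≤∣p∣+∣q∣ (L - v - w) ⁅ u ⁆ ⟩
      ∣ L - v - w ∣ + ∣ ⁅ u ⁆ ∣   ≡⟨ cong (∣ L - v - w ∣ +_) (∣⁅x⁆∣≡1 u) ⟩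
      ∣ L - v - w ∣ + 1           ≡⟨ +-comm ∣ L - v - w ∣ 1 ⟩
      suc ∣ L - v - w ∣           ≤⟨ x∈p⇒∣p-x∣<∣p∣ (x∈p∧x≢y⇒x∈p-y w∈L (λ w≡v → v≢w (sym w≡v))) ⟩
      ∣ L - v ∣                   <⟨ x∈p⇒∣p-x∣<∣p∣ v∈L ⟩
      ∣ L ∣                       ≤⟨ lineSize≤ L∈H ⟩
      r                           ∎
      where open ≤-Reasoning

    -- C meets L: the vertex of L on the side of u is either outside {v, w},
    -- or it is v (resp. w), which then equals u as both lie in L_v (resp. L_w).
    C-meets-L : ∃ λ x → x ∈ C × x ∈ L
    C-meets-L with partite L L∈H (side u)
    ... | x , x∈L , sx≡su , _ with x ≟ᶠ v | x ≟ᶠ w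
    ...   | yes refl | _        = u , u∈C , subst (_∈ L) (sameSide⇒≡ Lv∈H v∈Lv u∈Lv sx≡su) x∈L
    ...   | no _     | yes refl = u , u∈C , subst (_∈ L) (sameSide⇒≡ Lw∈H w∈Lw u∈Lw sx≡su) x∈L
    ...   | no x≢v   | no x≢w   = x , rest⊆C x∈L x≢v x≢w , x∈L

    -- a line through v is L or L_v, a line through w is L or L_w
    cover : IsCover H C
    cover = coverThroughLine H intersecting L∈H C meets
      where
      meets : ∀ {z M} → z ∈ L → M ∈H H → z ∈ M → ∃ λ x → x ∈ C × x ∈ M
      meets {z} z∈L M∈H z∈M with z ≟ᶠ v | z ≟ᶠ w
      ... | yes refl | _ with linesThroughV _ M∈H z∈M
      ...   | inj₁ refl = C-meets-L
      ...   | inj₂ refl = u , u∈C , u∈Lv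
      meets {z} z∈L M∈H z∈M | no _ | yes refl with linesThroughW _ M∈H z∈M
      ...   | inj₁ refl = C-meets-L
      ...   | inj₂ refl = u , u∈C , u∈Lw
      meets {z} z∈L M∈H z∈M | no z≢v | no z≢w = z , rest⊆C z∈L z≢v z≢w , z∈M

positive≢1⇒≥2 : ∀ {d} → 0 < d → d ≢ 1 → 2 ≤ d
positive≢1⇒≥2 {suc zero}    _ d≢1 = ⊥-elim (d≢1 refl)
positive≢1⇒≥2 {suc (suc d)} _ _   = s≤s (s≤s z≤n)

lemma2p1 : (n r : ℕ) → 2 ≤ r → (H : Hypergraph n) → (side : Fin n → Fin r) →
    IsPartition r H side → IsIntersecting H →
    (∀ v → 0 < degree H v) → CoverNumber≡ H r →
    (∀ i → r ≤ ∣ sideSet side i ∣) ×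
    (∀ v → 2 ≤ degree H v) ×
    (∀ L → L ∈H H → ∀ v w → v ∈ L → w ∈ L →
      degree H v ≡ 2 → degree H w ≡ 2 → v ≡ w)
lemma2p1 n r r≥2 H side partite intersecting noIsolated (_ , τ≥r) =
  sideSize≥r ,
  (λ v → positive≢1⇒≥2 (noIsolated v) (degree≢1 r≥2 intersecting v)) ,
  (λ L L∈H v w v∈L w∈L → degree2Unique intersecting L∈H v∈L w∈L)
  where open AtLeastRCover H side partite τ≥r
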